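{- Let $p$ be a binary word with exactly $2$ runs and of length $l \ge 3$. For every $n \ge l+2$ we have $B_{n,p}(M_{n,p}-1) = 0$; in particular, $p$ has an internal zero at every $n \ge l+2$.
   Context: A binary word is a finite sequence over $\{0,1\}$. An occurrence of $p = p_1\cdots p_l$ in $w = w_1\cdots w_n$ is a choice of indices $1 \le i_1 < \cdots < i_l \le n$ with $w_{i_1}\cdots w_{i_l} = p$; $c_p(w)$ is the number of occurrences, $B_{n,p}(k)$ is the number of binary words $w$ of length $n$ with $c_p(w)=k$, and $M_{n,p} = \max\{c_p(w) : w \in \{0,1\}^n\}$. A run is a maximal block of consecutive equal letters. The word $p$ has an internal zero at $n$ if there exist $0 \le k_1 < k_2 < k_3$ with $B_{n,p}(k_1) \ne 0$, $B_{n,p}(k_3) \ne 0$ and $B_{n,p}(k_2) = 0$. -}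

module Defs where

open import Data.Bool using (Bool; true; false; if_then_else_)
open import Data.Bool.Properties using () renaming (_≟_ to _≟B_)
open import Data.Nat using (ℕ; zero; suc; _+_; _⊔_; _<_)
open import Data.List using (List; []; _∷_; length; map; concatMap; foldr; filter)
open import Data.Product using (Σ-syntax; _×_; ∃-syntax)
open import Relation.Nullary using (¬_; does)
open import Relation.Binary.PropositionalEquality using (_≡_; _≢_)
open import Data.Nat.Properties using () renaming (_≟_ to _≟ℕ_)

-- binary words: lists of Bool (false = 0, true = 1)
Word : Set
Word = List Bool

words : ℕ → List Word
words zero = [] ∷ []
words (suc n) = concatMap (λ w → (false ∷ w) ∷ (true ∷ w) ∷ []) (words n)

-- c p w : number of occurrences of p in w as a (scattered) subsequence,
-- i.e. number of index choices i₁ < ... < i_l with w_{i₁}...w_{i_l} = p.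
-- Standard recursion: occurrences either avoid the first letter of w,
-- or use it as the image of the first letter of p.
c : Word → Word → ℕ
c [] w = 1
c (x ∷ p) [] = 0
c (x ∷ p) (y ∷ w) = c (x ∷ p) w + (if does (x ≟B y) then c p w else 0)

B : ℕ → Word → ℕ → ℕ
B n p k = length (filter (λ w → c p w ≟ℕ k) (words n))

M : ℕ → Word → ℕ
M n p = foldr (λ w m → c p w ⊔ m) 0 (words n)

runsFrom : Bool → Word → ℕ
runsFrom b [] = 0
runsFrom b (x ∷ w) = (if does (b ≟B x) then 0 else 1) + runsFrom x w

runs : Word → ℕ
runs [] = 0
runs (x ∷ w) = suc (runsFrom x w)

InternalZero : ℕ → Word → Set
InternalZero n p = ∃[ k₁ ] ∃[ k₂ ] ∃[ k₃ ]
  (k₁ < k₂ × k₂ < k₃ × B n p k₁ ≢ 0 × B n p k₃ ≢ 0 × B n p k₂ ≡ 0)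

-- Up to exchanging the two letters, which preserves all occurrence counts, p = 0ᵏ1ˡ with k, l ≥ 1
-- and k + l ≥ 3.  A word with z zeros and o ones contains p at most (z choose k)(o choose l) times,
-- with equality for the sorted word 0ᶻ1ᵒ, while an unsorted word falls short of this bound by at
-- least (z−1 choose k−1)(o−1 choose l−1).
--
-- Along the sorted words, F(z) = (z choose k)(n−z choose l) is unimodal, and
-- kl·(F(z+1) − F(z)) = (k(n−z) − l(z+1))·(z choose k−1)(n−z−1 choose l−1), where the binomial
-- product, when nonzero, is at least kl.  So F never rises by exactly 1 when n ≥ k + l + 2, and
-- every sorted count is either the maximum m or at most m − 2.  An unsorted word with m − 1
-- occurrences would fall short by exactly 1, which forces k = 1, o = l or l = 1, z = k; there a
-- neighbouring sorted word has more than m occurrences.  Hence m − 1 is never attained, while 0 and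
-- m are.

module Submission where

open import Defs
open import Data.Bool using (true; false; not)
open import Data.Bool.Properties using (not-involutive)
open import Data.List using ([]; _∷_; length; replicate; _++_; map; foldr; concatMap)
open import Data.List.Membership.Propositional using (_∈_)
open import Data.List.Properties
  using (length-++; length-replicate; length-map; map-∘; map-cong; map-id; map-++; map-replicate;
         filter-none; filter-some)
open import Data.List.Relation.Unary.All as All using (All; []; _∷_)
open import Data.List.Relation.Unary.Any as Any using (here; there)
open import Data.Nat
open import Data.Nat.Properties
open import Algebra.Properties.CommutativeSemigroup +-commutativeSemigroup
  using () renaming (interchange to +-interchange)
open import Algebra.Properties.CommutativeSemigroup *-commutativeSemigroup
  using () renaming (x∙yz≈y∙xz to x*[y*z]≡y*[x*z])
open import Data.Nat.Tactic.RingSolver using (solve-∀)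
open import Data.Product using (∃-syntax; _×_; _,_; proj₁; proj₂)
open import Data.Sum as Sum using (_⊎_; inj₁; inj₂; [_,_]′)
open import Function using (_∘_)
open import Relation.Binary.Definitions using (Tri; tri<; tri≈; tri>)
open import Relation.Binary.PropositionalEquality
open import Relation.Nullary using (yes; no; contradiction)

-- Binomial coefficients by Pascal's rule, rather than the library's factorial quotient, so that they
-- unfold in step with the recursion defining c.
infix 8 _choose_

_choose_ : ℕ → ℕ → ℕ
n     choose zero  = 1
zero  choose suc k = 0
suc n choose suc k = n choose k + n choose suc k

<⇒choose≡0 : ∀ {n k} → n < k → n choose k ≡ 0
<⇒choose≡0 {zero}  {suc k} _ = refl
<⇒choose≡0 {suc n} {suc k} (s≤s n<k)
  rewrite <⇒choose≡0 n<k | <⇒choose≡0 (m<n⇒m<1+n n<k) = refl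

≤⇒choose>0 : ∀ {n k} → k ≤ n → 0 < n choose k
≤⇒choose>0 {k = zero} _ = s≤s z≤n
≤⇒choose>0 {suc n} {suc k} (s≤s k≤n) = ≤-trans (≤⇒choose>0 k≤n) (m≤m+n _ _)

choose≡0⇒< : ∀ {n k} → n choose k ≡ 0 → n < k
choose≡0⇒< {n} {k} eq with k ≤? n
... | yes k≤n = contradiction (sym eq) (<⇒≢ (≤⇒choose>0 k≤n))
... | no k≰n = ≰⇒> k≰n

choose-1 : ∀ n → n choose 1 ≡ n
choose-1 zero    = refl
choose-1 (suc n) = cong suc (choose-1 n)

choose-diag : ∀ n → n choose n ≡ 1
choose-diag zero = refl
choose-diag (suc n) rewrite choose-diag n | <⇒choose≡0 (n<1+n n) = refl

suc-choose-diag : ∀ n → suc n choose n ≡ suc n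
suc-choose-diag zero = refl
suc-choose-diag (suc n) rewrite suc-choose-diag n | choose-diag (suc n) = +-comm (suc n) 1

choose-mono-suc : ∀ n k → n choose k ≤ suc n choose k
choose-mono-suc n zero    = ≤-refl
choose-mono-suc n (suc k) = m≤n+m (n choose suc k) (n choose k)

0<k<n⇒n≤choose : ∀ {n k} → 0 < k → k < n → n ≤ n choose k
0<k<n⇒n≤choose {suc n} {suc zero} _ _ rewrite choose-1 n = ≤-refl
0<k<n⇒n≤choose {suc n} {suc (suc k)} _ (s≤s k<n) =
  ≤-trans (≤-reflexive (+-comm 1 n)) (+-mono-≤ (0<k<n⇒n≤choose (s≤s z≤n) k<n) (≤⇒choose>0 k<n))

k<n⇒1+k≤choose : ∀ {n k} → k < n → suc k ≤ n choose k
k<n⇒1+k≤choose {k = zero}  _   = ≤-refl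
k<n⇒1+k≤choose {k = suc k} k<n = ≤-trans k<n (0<k<n⇒n≤choose (s≤s z≤n) k<n)

choose≡1+k⇒ : ∀ {n k} → k < n → n choose k ≡ suc k → k ≡ 0 ⊎ n ≡ suc k
choose≡1+k⇒ {k = zero} _ _ = inj₁ refl
choose≡1+k⇒ {n} {suc k} k<n eq with <-cmp n (suc (suc k))
... | tri< n<2+k _ _ = contradiction k<n (<⇒≱ n<2+k)
... | tri≈ _ n≡2+k _ = inj₂ n≡2+k
... | tri> _ _ 2+k<n = contradiction (subst (n ≤_) eq (0<k<n⇒n≤choose (s≤s z≤n) k<n)) (<⇒≱ 2+k<n)

choose≡1⇒ : ∀ {n k} → n choose k ≡ 1 → k ≡ 0 ⊎ k ≡ n
choose≡1⇒ {n} {zero} _ = inj₁ refl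
choose≡1⇒ {n} {suc k} eq with <-cmp (suc k) n
... | tri≈ _ 1+k≡n _ = inj₂ 1+k≡n
... | tri> _ _ n<1+k = contradiction (trans (sym eq) (<⇒choose≡0 n<1+k)) λ ()
... | tri< 1+k<n _ _ =
  contradiction (subst (2 ≤_) eq (≤-trans (s≤s (s≤s z≤n)) (k<n⇒1+k≤choose 1+k<n))) λ { (s≤s ()) }

choose-absorb : ∀ n k → suc k * n choose suc k ≡ (n ∸ k) * n choose k
choose-absorb zero zero = refl
choose-absorb zero (suc k) = *-zeroʳ (suc (suc k))
choose-absorb (suc n) zero rewrite choose-1 n = cong suc (trans (+-identityʳ n) (sym (*-identityʳ n)))
choose-absorb (suc n) (suc k) with k <? n
... | no k≮n
  rewrite <⇒choose≡0 (≰⇒> k≮n) | <⇒choose≡0 (m<n⇒m<1+n (≰⇒> k≮n))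
        | *-zeroʳ (suc (suc k)) | m≤n⇒m∸n≡0 (≮⇒≥ k≮n) = refl
... | yes k<n = begin
  suc (suc k) * (n choose suc k + n choose suc (suc k))
    ≡⟨ *-distribˡ-+ (suc (suc k)) (n choose suc k) _ ⟩
  suc (suc k) * P + suc (suc k) * n choose suc (suc k)
    ≡⟨ cong (suc (suc k) * P +_) (choose-absorb n (suc k)) ⟩
  suc (suc k) * P + (n ∸ suc k) * P
    ≡⟨ sym (*-distribʳ-+ P (suc (suc k)) (n ∸ suc k)) ⟩
  (suc (suc k) + (n ∸ suc k)) * P
    ≡⟨ cong (_* P) (cong suc (trans (m+[n∸m]≡n k<n) (sym (m+[n∸m]≡n (<⇒≤ k<n))))) ⟩
  (suc k + (n ∸ k)) * P
    ≡⟨ *-distribʳ-+ P (suc k) (n ∸ k) ⟩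
  suc k * P + (n ∸ k) * P
    ≡⟨ cong (_+ (n ∸ k) * P) (choose-absorb n k) ⟩
  (n ∸ k) * n choose k + (n ∸ k) * P
    ≡⟨ sym (*-distribˡ-+ (n ∸ k) (n choose k) P) ⟩
  (n ∸ k) * (n choose k + P) ∎
  where
  open ≡-Reasoning
  P = n choose suc k

zeros : Word → ℕ
zeros []          = 0
zeros (false ∷ w) = suc (zeros w)
zeros (true ∷ w)  = zeros w

ones : Word → ℕ
ones []          = 0
ones (false ∷ w) = ones w
ones (true ∷ w)  = suc (ones w)

length≡zeros+ones : ∀ w → length w ≡ zeros w + ones w
length≡zeros+ones []          = refl
length≡zeros+ones (false ∷ w) = cong suc (length≡zeros+ones w)
length≡zeros+ones (true ∷ w)  = trans (cong suc (length≡zeros+ones w)) (sym (+-suc (zeros w) (ones w)))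

ones≡n∸zeros : ∀ w {n} → length w ≡ n → ones w ≡ n ∸ zeros w
ones≡n∸zeros w refl = sym (trans (cong (_∸ zeros w) (length≡zeros+ones w)) (m+n∸m≡n (zeros w) (ones w)))

zeros≤length : ∀ w {n} → length w ≡ n → zeros w ≤ n
zeros≤length w refl = ≤-trans (m≤m+n (zeros w) (ones w)) (≤-reflexive (sym (length≡zeros+ones w)))

block : ℕ → ℕ → Word
block z o = replicate z false ++ replicate o true

length-block : ∀ z o → length (block z o) ≡ z + o
length-block z o =
  trans (length-++ (replicate z false)) (cong₂ _+_ (length-replicate z) (length-replicate o))

ones-block : ∀ z o → ones (block z o) ≡ o
ones-block zero    zero    = refl
ones-block zero    (suc o) = cong suc (ones-block zero o)
ones-block (suc z) o       = ones-block z o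

c-replicate-true : ∀ k w → c (replicate k true) w ≡ ones w choose k
c-replicate-true zero    w           = refl
c-replicate-true (suc k) []          = refl
c-replicate-true (suc k) (false ∷ w) = trans (+-identityʳ _) (c-replicate-true (suc k) w)
c-replicate-true (suc k) (true ∷ w)
  rewrite c-replicate-true (suc k) w | c-replicate-true k w = +-comm (ones w choose suc k) (ones w choose k)

c-block-ones : ∀ a b o → c (block (suc a) b) (replicate o true) ≡ 0
c-block-ones a b zero    = refl
c-block-ones a b (suc o) = trans (+-identityʳ _) (c-block-ones a b o)

c-block≤ : ∀ a b w → c (block a b) w ≤ zeros w choose a * ones w choose b
c-block≤ zero b w = ≤-reflexive (trans (c-replicate-true b w) (sym (+-identityʳ _)))
c-block≤ (suc a) b [] = z≤n
c-block≤ (suc a) b (true ∷ w) = begin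
  c (block (suc a) b) w + 0                    ≡⟨ +-identityʳ _ ⟩
  c (block (suc a) b) w                        ≤⟨ c-block≤ (suc a) b w ⟩
  zeros w choose suc a * ones w choose b       ≤⟨ *-monoʳ-≤ (zeros w choose suc a) (choose-mono-suc (ones w) b) ⟩
  zeros w choose suc a * suc (ones w) choose b ∎
  where open ≤-Reasoning
c-block≤ (suc a) b (false ∷ w) = begin
  c (block (suc a) b) w + c (block a b) w                  ≤⟨ +-mono-≤ (c-block≤ (suc a) b w) (c-block≤ a b w) ⟩
  zeros w choose suc a * O + zeros w choose a * O          ≡⟨ +-comm (zeros w choose suc a * O) _ ⟩
  zeros w choose a * O + zeros w choose suc a * O          ≡⟨ *-distribʳ-+ O (zeros w choose a) _ ⟨
  (zeros w choose a + zeros w choose suc a) * O            ∎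
  where
  open ≤-Reasoning
  O = ones w choose b

c-block-block : ∀ a b z o → c (block a b) (block z o) ≡ z choose a * o choose b
c-block-block zero b z o =
  trans (c-replicate-true b (block z o)) (trans (cong (_choose b) (ones-block z o)) (sym (+-identityʳ _)))
c-block-block (suc a) b zero o = c-block-ones a b o
c-block-block (suc a) b (suc z) o rewrite c-block-block (suc a) b z o | c-block-block a b z o =
  trans (+-comm (z choose suc a * o choose b) _) (sym (*-distribʳ-+ (o choose b) (z choose a) (z choose suc a)))

data Unsorted : Word → Set where
  here  : ∀ {w} → 0 < zeros w → Unsorted (true ∷ w)
  there : ∀ {x w} → Unsorted w → Unsorted (x ∷ w)

Unsorted⇒0<zeros : ∀ {w} → Unsorted w → 0 < zeros w
Unsorted⇒0<zeros (here 0<z)          = 0<z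
Unsorted⇒0<zeros (there {false} _)   = s≤s z≤n
Unsorted⇒0<zeros (there {true} u)    = Unsorted⇒0<zeros u

Unsorted⇒0<ones : ∀ {w} → Unsorted w → 0 < ones w
Unsorted⇒0<ones (here _)          = s≤s z≤n
Unsorted⇒0<ones (there {false} u) = Unsorted⇒0<ones u
Unsorted⇒0<ones (there {true} _)  = s≤s z≤n

unsorted-or-sorted : ∀ w → Unsorted w ⊎ w ≡ block (zeros w) (ones w)
unsorted-or-sorted [] = inj₂ refl
unsorted-or-sorted (x ∷ w) with unsorted-or-sorted w
... | inj₁ u = inj₁ (there u)
unsorted-or-sorted (false ∷ w) | inj₂ sorted = inj₂ (cong (false ∷_) sorted)
unsorted-or-sorted (true ∷ w)  | inj₂ sorted with zeros w in eq
... | suc _ = inj₁ (here (subst (0 <_) (sym eq) (s≤s z≤n)))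
... | zero  = inj₂ (cong (true ∷_) sorted)

-- Fix a 1 standing before a 0 in w.  Choosing that 0 as one of the a zeros and that 1 as one of the
-- b + 1 ones never yields an occurrence of 0ᵃ1ᵇ⁺¹, so at least (z − 1 choose a − 1)(o − 1 choose b)
-- of the choices counted by c-block≤ are not occurrences.
deficit : ℕ → ℕ → ℕ → ℕ → ℕ
deficit zero    z o b = 0
deficit (suc a) z o b = (z ∸ 1) choose a * (o ∸ 1) choose b

deficit-step : ∀ a b {z} o → 0 < z → deficit (suc a) (suc z) o b ≡ deficit (suc a) z o b + deficit a z o b
deficit-step zero    b o (s≤s _) = sym (+-identityʳ _)
deficit-step (suc a) b {suc z} o _ =
  trans (*-distribʳ-+ ((o ∸ 1) choose b) (z choose a) _) (+-comm (z choose a * _) _)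

pred-choose≤choose-suc : ∀ {z} a → 0 < z → (z ∸ 1) choose a ≤ z choose suc a
pred-choose≤choose-suc {suc z} a _ = m≤m+n (z choose a) _

c-unsorted : ∀ a b {w} → Unsorted w →
  c (block a (suc b)) w + deficit a (zeros w) (ones w) b ≤ zeros w choose a * ones w choose suc b
c-unsorted zero b {w} _ = ≤-reflexive (cong (_+ 0) (c-replicate-true (suc b) w))
c-unsorted (suc a) b {true ∷ w} u = begin
  c (block (suc a) (suc b)) w + 0 + (zeros w ∸ 1) choose a * ones w choose b
    ≤⟨ +-mono-≤ (≤-reflexive (+-identityʳ _))
                (*-monoˡ-≤ _ (pred-choose≤choose-suc a (Unsorted⇒0<zeros u))) ⟩
  c (block (suc a) (suc b)) w + Z * ones w choose b
    ≤⟨ +-monoˡ-≤ _ (c-block≤ (suc a) (suc b) w) ⟩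
  Z * ones w choose suc b + Z * ones w choose b
    ≡⟨ +-comm (Z * ones w choose suc b) _ ⟩
  Z * ones w choose b + Z * ones w choose suc b
    ≡⟨ *-distribˡ-+ Z (ones w choose b) _ ⟨
  Z * (ones w choose b + ones w choose suc b) ∎
  where
  open ≤-Reasoning
  Z = zeros w choose suc a
c-unsorted (suc a) b {false ∷ w} (there u) = begin
  x + y + deficit (suc a) (suc (zeros w)) (ones w) b
                                                     ≡⟨ cong (x + y +_) (deficit-step a b (ones w) (Unsorted⇒0<zeros u)) ⟩
  x + y + (d₁ + d₂)                                  ≡⟨ +-interchange x y d₁ d₂ ⟩
  (x + d₁) + (y + d₂)                                ≤⟨ +-mono-≤ (c-unsorted (suc a) b u) (c-unsorted a b u) ⟩
  zeros w choose suc a * O + zeros w choose a * O    ≡⟨ +-comm (zeros w choose suc a * O) _ ⟩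
  zeros w choose a * O + zeros w choose suc a * O    ≡⟨ *-distribʳ-+ O (zeros w choose a) _ ⟨
  (zeros w choose a + zeros w choose suc a) * O      ∎
  where
  open ≤-Reasoning
  x = c (block (suc a) (suc b)) w
  y = c (block a (suc b)) w
  d₁ = deficit (suc a) (zeros w) (ones w) b
  d₂ = deficit a (zeros w) (ones w) b
  O = ones w choose suc b

-- Passing from 0ᶻ1ᵗ⁺¹ to 0ᶻ⁺¹1ᵗ gains `gain a b z t` and loses `loss a b z t`
-- occurrences of 0ᵃ⁺¹1ᵇ⁺¹.
gain loss base : ℕ → ℕ → ℕ → ℕ → ℕ
gain a b z t = z choose a * t choose suc b
loss a b z t = z choose suc a * t choose b
base a b z t = z choose a * t choose b

boundary-shift : ∀ a b z t →
  z choose suc a * suc t choose suc b + gain a b z t ≡ suc z choose suc a * t choose suc b + loss a b z t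
boundary-shift a b z t = shift (z choose suc a) (t choose b) (t choose suc b) (z choose a)
  where
  shift : ∀ x y y′ x′ → x * (y + y′) + x′ * y′ ≡ (x′ + x) * y′ + x * y
  shift = solve-∀

suc-*-gain : ∀ a b z t → suc b * gain a b z t ≡ (t ∸ b) * base a b z t
suc-*-gain a b z t = begin
  suc b * (z choose a * t choose suc b)   ≡⟨ x*[y*z]≡y*[x*z] (suc b) (z choose a) (t choose suc b) ⟩
  z choose a * (suc b * t choose suc b)   ≡⟨ cong (z choose a *_) (choose-absorb t b) ⟩
  z choose a * ((t ∸ b) * t choose b)     ≡⟨ x*[y*z]≡y*[x*z] (z choose a) (t ∸ b) (t choose b) ⟩
  (t ∸ b) * base a b z t                  ∎
  where open ≡-Reasoning

suc-*-loss : ∀ a b z t → suc a * loss a b z t ≡ (z ∸ a) * base a b z t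
suc-*-loss a b z t = begin
  suc a * (z choose suc a * t choose b)   ≡⟨ *-assoc (suc a) (z choose suc a) (t choose b) ⟨
  suc a * z choose suc a * t choose b     ≡⟨ cong (_* t choose b) (choose-absorb z a) ⟩
  (z ∸ a) * z choose a * t choose b       ≡⟨ *-assoc (z ∸ a) (z choose a) (t choose b) ⟩
  (z ∸ a) * base a b z t                  ∎
  where open ≡-Reasoning

scaled-gain : ∀ a b z t → suc a * (suc b * gain a b z t) ≡ suc a * (t ∸ b) * base a b z t
scaled-gain a b z t = trans (cong (suc a *_) (suc-*-gain a b z t)) (sym (*-assoc (suc a) (t ∸ b) (base a b z t)))

scaled-loss : ∀ a b z t → suc a * (suc b * loss a b z t) ≡ suc b * (z ∸ a) * base a b z t
scaled-loss a b z t = begin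
  suc a * (suc b * loss a b z t)   ≡⟨ x*[y*z]≡y*[x*z] (suc a) (suc b) (loss a b z t) ⟩
  suc b * (suc a * loss a b z t)   ≡⟨ cong (suc b *_) (suc-*-loss a b z t) ⟩
  suc b * ((z ∸ a) * base a b z t) ≡⟨ *-assoc (suc b) (z ∸ a) (base a b z t) ⟨
  suc b * (z ∸ a) * base a b z t   ∎
  where open ≡-Reasoning

gain-loss-vanish : ∀ a b z t → z < a ⊎ t < b → gain a b z t ≡ 0 × loss a b z t ≡ 0
gain-loss-vanish a b z t (inj₁ z<a)
  rewrite <⇒choose≡0 z<a | <⇒choose≡0 (m<n⇒m<1+n z<a) = refl , refl
gain-loss-vanish a b z t (inj₂ t<b)
  rewrite <⇒choose≡0 t<b | <⇒choose≡0 (m<n⇒m<1+n t<b) = *-zeroʳ (z choose a) , *-zeroʳ (z choose suc a)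

suc-*-suc-split : ∀ a b z → a ≤ z → suc b * suc z ≡ suc b * (z ∸ a) + suc b * suc a
suc-*-suc-split a b z a≤z = begin
  suc b * suc z                   ≡⟨ cong (λ x → suc b * suc x) (m∸n+n≡m a≤z) ⟨
  suc b * suc (z ∸ a + a)         ≡⟨ cong (suc b *_) (+-suc (z ∸ a) a) ⟨
  suc b * (z ∸ a + suc a)         ≡⟨ *-distribˡ-+ (suc b) (z ∸ a) (suc a) ⟩
  suc b * (z ∸ a) + suc b * suc a ∎
  where open ≡-Reasoning

≡0⇒≤ : ∀ {m n} → m ≡ 0 → m ≤ n
≡0⇒≤ refl = z≤n

gain≤loss : ∀ a b z t → suc a * suc t ≤ suc b * suc z → gain a b z t ≤ loss a b z t
gain≤loss a b z t le with z <? a | t <? b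
... | yes z<a | _       = ≡0⇒≤ (proj₁ (gain-loss-vanish a b z t (inj₁ z<a)))
... | no _    | yes t<b = ≡0⇒≤ (proj₁ (gain-loss-vanish a b z t (inj₂ t<b)))
... | no z≮a  | no t≮b  = *-cancelˡ-≤ (suc b) (*-cancelˡ-≤ (suc a) (begin
  suc a * (suc b * gain a b z t)  ≡⟨ scaled-gain a b z t ⟩
  suc a * (t ∸ b) * base a b z t  ≤⟨ *-monoˡ-≤ (base a b z t) ratio ⟩
  suc b * (z ∸ a) * base a b z t  ≡⟨ scaled-loss a b z t ⟨
  suc a * (suc b * loss a b z t)  ∎))
  where
  open ≤-Reasoning
  ratio : suc a * (t ∸ b) ≤ suc b * (z ∸ a)
  ratio = +-cancelʳ-≤ (suc a * suc b) _ _ (begin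
    suc a * (t ∸ b) + suc a * suc b  ≡⟨ suc-*-suc-split b a t (≮⇒≥ t≮b) ⟨
    suc a * suc t                    ≤⟨ le ⟩
    suc b * suc z                    ≡⟨ suc-*-suc-split a b z (≮⇒≥ z≮a) ⟩
    suc b * (z ∸ a) + suc b * suc a  ≡⟨ cong (suc b * (z ∸ a) +_) (*-comm (suc b) (suc a)) ⟩
    suc b * (z ∸ a) + suc a * suc b  ∎)

loss≤gain : ∀ a b z t → suc b * suc z < suc a * suc t → loss a b z t ≤ gain a b z t
loss≤gain a b z t lt with z <? a | t <? b
... | yes z<a | _       = ≡0⇒≤ (proj₂ (gain-loss-vanish a b z t (inj₁ z<a)))
... | no _    | yes t<b = ≡0⇒≤ (proj₂ (gain-loss-vanish a b z t (inj₂ t<b)))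
... | no z≮a  | no t≮b  = *-cancelˡ-≤ (suc b) (*-cancelˡ-≤ (suc a) (begin
  suc a * (suc b * loss a b z t)  ≡⟨ scaled-loss a b z t ⟩
  suc b * (z ∸ a) * base a b z t  ≤⟨ *-monoˡ-≤ (base a b z t) (<⇒≤ ratio) ⟩
  suc a * (t ∸ b) * base a b z t  ≡⟨ scaled-gain a b z t ⟨
  suc a * (suc b * gain a b z t)  ∎))
  where
  open ≤-Reasoning
  ratio : suc b * (z ∸ a) < suc a * (t ∸ b)
  ratio = +-cancelʳ-< (suc a * suc b) _ _ (begin-strict
    suc b * (z ∸ a) + suc a * suc b  ≡⟨ cong (suc b * (z ∸ a) +_) (*-comm (suc b) (suc a)) ⟨
    suc b * (z ∸ a) + suc b * suc a  ≡⟨ suc-*-suc-split a b z (≮⇒≥ z≮a) ⟨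
    suc b * suc z                    <⟨ lt ⟩
    suc a * suc t                    ≡⟨ suc-*-suc-split b a t (≮⇒≥ t≮b) ⟩
    suc a * (t ∸ b) + suc a * suc b  ∎)

*-squeeze : ∀ {m n u v} .{{_ : NonZero m}} .{{_ : NonZero n}} →
  m ≤ u → n ≤ v → u * v ≡ m * n → u ≡ m × v ≡ n
*-squeeze {m} {n} {u} {v} m≤u n≤v uv≡mn = ≤-antisym u≤m m≤u , ≤-antisym v≤n n≤v
  where
  open ≤-Reasoning
  u≤m : u ≤ m
  u≤m = ≮⇒≥ λ m<u → <-irrefl refl (begin-strict
    m * n  <⟨ *-monoˡ-< n m<u ⟩
    u * n  ≤⟨ *-monoʳ-≤ u n≤v ⟩
    u * v  ≡⟨ uv≡mn ⟩
    m * n  ∎)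
  v≤n : v ≤ n
  v≤n = ≮⇒≥ λ n<v → <-irrefl refl (begin-strict
    m * n  <⟨ *-monoʳ-< m n<v ⟩
    m * v  ≤⟨ *-monoˡ-≤ v m≤u ⟩
    u * v  ≡⟨ uv≡mn ⟩
    m * n  ∎)

-- Scaled by (a + 1)(b + 1), gain = loss + 1 reads (a+1)(t−b)·base = (a+1)(b+1) + (b+1)(z−a)·base;
-- as base ≥ (a+1)(b+1), this forces base = (a+1)(b+1).
gain≡1+loss⇒extremal : ∀ {a b z t} → a < z → b < t → gain a b z t ≡ suc (loss a b z t) →
  z choose a ≡ suc a × t choose b ≡ suc b × suc a * (t ∸ b) ≡ suc (suc b * (z ∸ a))
gain≡1+loss⇒extremal {a} {b} {z} {t} a<z b<t unit-step =
  let u≡a , v≡b = *-squeeze (k<n⇒1+k≤choose a<z) (k<n⇒1+k≤choose b<t) K≡ab in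
  u≡a , v≡b , *-cancelʳ-≡ G (suc L) K (trans balance (cong (_+ L * K) (sym K≡ab)))
  where
  K = base a b z t
  ab = suc a * suc b
  G = suc a * (t ∸ b)
  L = suc b * (z ∸ a)
  open ≤-Reasoning
  balance : G * K ≡ ab + L * K
  balance = begin-equality
    G * K                              ≡⟨ scaled-gain a b z t ⟨
    suc a * (suc b * gain a b z t)     ≡⟨ cong (λ x → suc a * (suc b * x)) unit-step ⟩
    suc a * (suc b * suc (loss a b z t)) ≡⟨ expand (suc a) (suc b) (loss a b z t) ⟩
    ab + suc a * (suc b * loss a b z t) ≡⟨ cong (ab +_) (scaled-loss a b z t) ⟩
    ab + L * K                          ∎
    where
    expand : ∀ x y w → x * (y * suc w) ≡ x * y + x * (y * w)
    expand = solve-∀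
  ab≤K : ab ≤ K
  ab≤K = *-mono-≤ (k<n⇒1+k≤choose a<z) (k<n⇒1+k≤choose b<t)
  L<G : L < G
  L<G = ≰⇒> λ G≤L → <-irrefl refl (begin-strict
    G * K       ≤⟨ *-monoˡ-≤ K G≤L ⟩
    L * K       <⟨ m<n+m (L * K) (s≤s z≤n) ⟩
    ab + L * K  ≡⟨ balance ⟨
    G * K       ∎)
  K≤ab : K ≤ ab
  K≤ab = +-cancelʳ-≤ (L * K) K ab (begin
    K + L * K   ≤⟨ *-monoˡ-≤ K L<G ⟩
    G * K       ≡⟨ balance ⟩
    ab + L * K  ∎)
  K≡ab : K ≡ ab
  K≡ab = ≤-antisym K≤ab ab≤K
  instance
    K≢0 : NonZero K
    K≢0 = >-nonZero (≤-trans (s≤s z≤n) ab≤K)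

m+n+o≤m+p⇒n+o≤p : ∀ m n o {p} → m + n + o ≤ m + p → n + o ≤ p
m+n+o≤m+p⇒n+o≤p m n o {p} le = +-cancelˡ-≤ m (n + o) p (subst (_≤ m + p) (+-assoc m n o) le)

extremal-impossible : ∀ {a b z t} → 3 ≤ suc a + suc b → suc a + suc b + 2 ≤ z + suc t → 0 < z →
  a ≡ 0 ⊎ z ≡ suc a → b ≡ 0 ⊎ t ≡ suc b → suc a * (t ∸ b) ≢ suc (suc b * (z ∸ a))
extremal-impossible (s≤s (s≤s ())) _ _ (inj₁ refl) (inj₁ refl)
extremal-impossible {a} {b} _ size _ (inj₂ refl) (inj₂ refl) _ =
  1+n≰n (subst (_≤ suc (suc b)) (+-comm (suc b) 2) (m+n+o≤m+p⇒n+o≤p (suc a) (suc b) 2 size))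
extremal-impossible {b = b} {suc z} _ _ _ (inj₁ refl) (inj₂ refl) ratio
  rewrite m+n∸n≡m 1 b = contradiction (suc-injective ratio) λ ()
extremal-impossible {zero} (s≤s (s≤s ())) _ _ (inj₂ refl) (inj₁ refl)
extremal-impossible {suc a} {t = t} _ size _ (inj₂ refl) (inj₁ refl) ratio
  rewrite m+n∸n≡m 1 (suc a) =
  contradiction (subst (4 ≤_) ratio (*-mono-≤ {2} {suc (suc a)} (s≤s (s≤s z≤n)) 2≤t)) λ { (s≤s (s≤s ())) }
  where
  2≤t : 2 ≤ t
  2≤t = s≤s⁻¹ (m+n+o≤m+p⇒n+o≤p (suc (suc a)) 1 2 size)

gain≢1+loss : ∀ {a b z t} → 3 ≤ suc a + suc b → suc a + suc b + 2 ≤ z + suc t →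
  gain a b z t ≢ suc (loss a b z t)
gain≢1+loss {a} {b} {z} {t} 3≤ size unit-step with t ≤? b | <-cmp a z
... | yes t≤b | _ = 0≢1+n (trans (sym gain≡0) unit-step)
  where
  gain≡0 : gain a b z t ≡ 0
  gain≡0 = trans (cong (z choose a *_) (<⇒choose≡0 (s≤s t≤b))) (*-zeroʳ (z choose a))
... | no _ | tri> _ _ z<a = 0≢1+n (trans (sym (proj₁ (gain-loss-vanish a b z t (inj₁ z<a)))) unit-step)
... | no _ | tri≈ _ refl _ =
  [ (λ ()) , (λ 1+b≡t → m+1+n≰m (suc b) (subst (suc b + 2 ≤_) (sym 1+b≡t) 3+b≤t)) ]′
    (choose≡1⇒ column≡1)
  where
  3+b≤t : suc b + 2 ≤ t
  3+b≤t = m+n+o≤m+p⇒n+o≤p (suc a) (suc b) 2 (subst (suc a + suc b + 2 ≤_) (+-suc a t) size)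
  column≡1 : t choose suc b ≡ 1
  column≡1 = begin
    t choose suc b                    ≡⟨ *-identityˡ (t choose suc b) ⟨
    1 * t choose suc b                ≡⟨ cong (_* t choose suc b) (choose-diag a) ⟨
    a choose a * t choose suc b       ≡⟨ unit-step ⟩
    suc (a choose suc a * t choose b) ≡⟨ cong (λ x → suc (x * t choose b)) (<⇒choose≡0 (n<1+n a)) ⟩
    1                                 ∎
    where open ≡-Reasoning
... | no t≰b | tri< a<z _ _ =
  let z-row , t-row , ratio = gain≡1+loss⇒extremal a<z b<t unit-step in
  extremal-impossible 3≤ size (≤-trans (s≤s z≤n) a<z) (choose≡1+k⇒ a<z z-row) (choose≡1+k⇒ b<t t-row) ratio
  where
  b<t : b < t
  b<t = ≰⇒> t≰b

-- F(z) for p = 0ᵃ⁺¹1ᵇ⁺¹: the number of occurrences of p in 0ᶻ1ⁿ⁻ᶻ (see c-block-block).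
sortedCount : ℕ → ℕ → ℕ → ℕ → ℕ
sortedCount a b n z = z choose suc a * (n ∸ z) choose suc b

sortedCount-reflect : ∀ a b {n z} → z ≤ n → sortedCount a b n z ≡ sortedCount b a n (n ∸ z)
sortedCount-reflect a b {n} {z} z≤n′ rewrite m∸[m∸n]≡n z≤n′ = *-comm (z choose suc a) _

sortedCount-step : ∀ a b {n z} → z < n →
  sortedCount a b n z + gain a b z (n ∸ suc z) ≡ sortedCount a b n (suc z) + loss a b z (n ∸ suc z)
sortedCount-step a b {n} {z} z<n rewrite +-∸-assoc 1 z<n = boundary-shift a b z (n ∸ suc z)

sortedCount-rises : ∀ a b {n z} → z < n → suc b * suc z < suc a * (n ∸ z) →
  sortedCount a b n z ≤ sortedCount a b n (suc z)
sortedCount-rises a b {n} {z} z<n slope = +-cancelʳ-≤ (gain a b z t) _ _ (begin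
  sortedCount a b n z + gain a b z t        ≡⟨ sortedCount-step a b z<n ⟩
  sortedCount a b n (suc z) + loss a b z t  ≤⟨ +-monoʳ-≤ _ (loss≤gain a b z t slope′) ⟩
  sortedCount a b n (suc z) + gain a b z t  ∎)
  where
  open ≤-Reasoning
  t = n ∸ suc z
  slope′ : suc b * suc z < suc a * suc t
  slope′ = subst (λ x → suc b * suc z < suc a * x) (+-∸-assoc 1 z<n) slope

sortedCount-falls : ∀ a b {n z} → z < n → suc a * (n ∸ z) ≤ suc b * suc z →
  sortedCount a b n (suc z) ≤ sortedCount a b n z
sortedCount-falls a b {n} {z} z<n slope = +-cancelʳ-≤ (loss a b z t) _ _ (begin
  sortedCount a b n (suc z) + loss a b z t  ≡⟨ sortedCount-step a b z<n ⟨
  sortedCount a b n z + gain a b z t        ≤⟨ +-monoʳ-≤ _ (gain≤loss a b z t slope′) ⟩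
  sortedCount a b n z + loss a b z t        ∎)
  where
  open ≤-Reasoning
  t = n ∸ suc z
  slope′ : suc a * suc t ≤ suc b * suc z
  slope′ = subst (λ x → suc a * x ≤ suc b * suc z) (+-∸-assoc 1 z<n) slope

-- The slope condition (a + 1)(n − z) ≤ (b + 1)(z + 1) is preserved when z grows, so a descent never ends.
sortedCount-falls-from : ∀ a b {n z} → suc a * (n ∸ z) ≤ suc b * suc z →
  ∀ {y} → z ≤ y → y ≤ n → sortedCount a b n y ≤ sortedCount a b n z
sortedCount-falls-from a b {n} {z} slope z≤y = go (≤⇒≤′ z≤y)
  where
  go : ∀ {y} → z ≤′ y → y ≤ n → sortedCount a b n y ≤ sortedCount a b n z
  go ≤′-refl _ = ≤-refl
  go {suc y} (≤′-step z≤′y) y<n = ≤-trans (sortedCount-falls a b y<n slope-at-y) (go z≤′y (<⇒≤ y<n))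
    where
    z≤y′ = ≤′⇒≤ z≤′y
    slope-at-y : suc a * (n ∸ y) ≤ suc b * suc y
    slope-at-y = ≤-trans (*-monoʳ-≤ (suc a) (∸-monoʳ-≤ n z≤y′))
                         (≤-trans slope (*-monoʳ-≤ (suc b) (s≤s z≤y′)))

sortedCount-rise-gap : ∀ {a b n z} → 3 ≤ suc a + suc b → suc a + suc b + 2 ≤ n → z < n →
  sortedCount a b n z < sortedCount a b n (suc z) → sortedCount a b n z + 2 ≤ sortedCount a b n (suc z)
sortedCount-rise-gap {a} {b} {n} {z} 3≤ size z<n rise = +-cancelʳ-≤ (loss a b z t) _ _ (begin
  F z + 2 + loss a b z t    ≡⟨ +-assoc (F z) 2 _ ⟩
  F z + (2 + loss a b z t)  ≡⟨ cong (F z +_) (+-comm 2 _) ⟩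
  F z + (loss a b z t + 2)  ≤⟨ +-monoʳ-≤ (F z) loss+2≤gain ⟩
  F z + gain a b z t        ≡⟨ sortedCount-step a b z<n ⟩
  F (suc z) + loss a b z t  ∎)
  where
  open ≤-Reasoning
  F = sortedCount a b n
  t = n ∸ suc z
  loss<gain : loss a b z t < gain a b z t
  loss<gain = ≰⇒> λ gain≤loss → <⇒≱ rise (+-cancelʳ-≤ (loss a b z t) _ _ (begin
    F (suc z) + loss a b z t  ≡⟨ sortedCount-step a b z<n ⟨
    F z + gain a b z t        ≤⟨ +-monoʳ-≤ (F z) gain≤loss ⟩
    F z + loss a b z t        ∎))
  size′ : suc a + suc b + 2 ≤ z + suc t
  size′ = subst (_ ≤_) (sym (trans (+-suc z t) (m+[n∸m]≡n z<n))) size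
  loss+2≤gain : loss a b z t + 2 ≤ gain a b z t
  loss+2≤gain = subst (_≤ gain a b z t) (+-comm 2 _) (≤∧≢⇒< loss<gain (gain≢1+loss 3≤ size′ ∘ sym))

sortedCount-fall-persists : ∀ a b {n z} → z < n → sortedCount a b n (suc z) < sortedCount a b n z →
  ∀ {y} → z ≤ y → y ≤ n → sortedCount a b n y ≤ sortedCount a b n z
sortedCount-fall-persists a b z<n fall =
  sortedCount-falls-from a b (≮⇒≥ λ slope → <⇒≱ fall (sortedCount-rises a b z<n slope))

argmax : (f : ℕ → ℕ) (n : ℕ) → ∃[ z ] z ≤ n × (∀ {y} → y ≤ n → f y ≤ f z)
argmax f zero = 0 , z≤n , λ { z≤n → ≤-refl }
argmax f (suc n) with argmax f n
... | z , z≤n′ , f≤fz with f z ≤? f (suc n)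
...   | yes fz≤ = suc n , ≤-refl ,
  [ (λ y<1+n → ≤-trans (f≤fz (m<1+n⇒m≤n y<1+n)) fz≤) , (λ { refl → ≤-refl }) ]′ ∘ m≤n⇒m<n∨m≡n
...   | no fz≰ = z , m≤n⇒m≤1+n z≤n′ ,
  [ (λ y<1+n → f≤fz (m<1+n⇒m≤n y<1+n)) , (λ { refl → <⇒≤ (≰⇒> fz≰) }) ]′ ∘ m≤n⇒m<n∨m≡n

module _ (f : ℕ → ℕ) {n : ℕ}
  (rise-gap : ∀ {z} → z < n → f z < f (suc z) → f z + 2 ≤ f (suc z))
  (fall-persists : ∀ {z} → z < n → f (suc z) < f z → ∀ {y} → z ≤ y → y ≤ n → f y ≤ f z)
  {peak : ℕ} (peak≤n : peak ≤ n) (f≤f-peak : ∀ {y} → y ≤ n → f y ≤ f peak)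
  where

  left-of-peak : ∀ {z} → z ≤ peak → f z ≡ f peak ⊎ f z + 2 ≤ f peak
  left-of-peak {z} z≤peak = walk (peak ∸ z) (m+[n∸m]≡n z≤peak)
    where
    walk : ∀ k {z} → z + k ≡ peak → f z ≡ f peak ⊎ f z + 2 ≤ f peak
    walk zero {z} z+0≡peak = inj₁ (cong f (trans (sym (+-identityʳ z)) z+0≡peak))
    walk (suc k) {z} z+1+k≡peak = by-step (<-cmp (f z) (f (suc z)))
      where
      z<peak : z < peak
      z<peak = subst (z <_) z+1+k≡peak (m<m+n z (s≤s z≤n))
      z<n : z < n
      z<n = <-≤-trans z<peak peak≤n
      by-step : Tri (f z < f (suc z)) (f z ≡ f (suc z)) (f (suc z) < f z) → f z ≡ f peak ⊎ f z + 2 ≤ f peak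
      by-step (tri< rise _ _) = inj₂ (≤-trans (rise-gap z<n rise) (f≤f-peak z<n))
      by-step (tri≈ _ flat _) = Sum.map (trans flat) (subst (λ x → x + 2 ≤ f peak) (sym flat))
                                        (walk k (trans (sym (+-suc z k)) z+1+k≡peak))
      by-step (tri> _ _ fall) =
        inj₁ (≤-antisym (f≤f-peak (<⇒≤ z<n)) (fall-persists z<n fall (<⇒≤ z<peak) peak≤n))

sortedCount-max-or-gap : ∀ {a b n peak} → 3 ≤ suc a + suc b → suc a + suc b + 2 ≤ n →
  peak ≤ n → (∀ {y} → y ≤ n → sortedCount a b n y ≤ sortedCount a b n peak) →
  ∀ {z} → z ≤ n →
  sortedCount a b n z ≡ sortedCount a b n peak ⊎ sortedCount a b n z + 2 ≤ sortedCount a b n peak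
sortedCount-max-or-gap {a} {b} {n} {peak} 3≤ size peak≤n is-max {z} z≤n′ with z ≤? peak
... | yes z≤peak =
  left-of-peak (sortedCount a b n) (sortedCount-rise-gap 3≤ size) (sortedCount-fall-persists a b) peak≤n is-max z≤peak
... | no z≰peak =
  Sum.map (λ eq → trans (reflect z≤n′) (trans eq (sym (reflect peak≤n))))
          (subst₂ (λ x y → x + 2 ≤ y) (sym (reflect z≤n′)) (sym (reflect peak≤n)))
          (left-of-peak (sortedCount b a n) (sortedCount-rise-gap 3≤′ size′) (sortedCount-fall-persists b a)
                        (m∸n≤m n peak) is-max′ (∸-monoʳ-≤ n (<⇒≤ (≰⇒> z≰peak))))
  where
  reflect : ∀ {x} → x ≤ n → sortedCount a b n x ≡ sortedCount b a n (n ∸ x)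
  reflect = sortedCount-reflect a b
  3≤′ : 3 ≤ suc b + suc a
  3≤′ = subst (3 ≤_) (+-comm (suc a) (suc b)) 3≤
  size′ : suc b + suc a + 2 ≤ n
  size′ = subst (λ x → x + 2 ≤ n) (+-comm (suc a) (suc b)) size
  is-max′ : ∀ {y} → y ≤ n → sortedCount b a n y ≤ sortedCount b a n (n ∸ peak)
  is-max′ {y} y≤n = subst₂ _≤_ (sym (sortedCount-reflect b a y≤n)) (reflect peak≤n) (is-max (m∸n≤m n y))

pred-choose≡0⇒choose-suc≡0 : ∀ {z} k → 0 < z → (z ∸ 1) choose k ≡ 0 → z choose suc k ≡ 0
pred-choose≡0⇒choose-suc≡0 {suc z} k _ eq = <⇒choose≡0 (s≤s (choose≡0⇒< {z} {k} eq))

unsorted-deficit-pos : ∀ a b {w} → Unsorted w → 0 < c (block (suc a) (suc b)) w →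
  0 < deficit (suc a) (zeros w) (ones w) b
unsorted-deficit-pos a b {w} u 0<count = n≢0⇒n>0 λ deficit≡0 →
  <⇒≱ 0<count (≤-trans (c-block≤ (suc a) (suc b) w) (≤-reflexive
    ([ (λ P≡0 → cong (_* ones w choose suc b) (pred-choose≡0⇒choose-suc≡0 a (Unsorted⇒0<zeros u) P≡0))
     , (λ Q≡0 → trans (cong (zeros w choose suc a *_) (pred-choose≡0⇒choose-suc≡0 b (Unsorted⇒0<ones u) Q≡0))
                       (*-zeroʳ (zeros w choose suc a)))
     ]′ (m*n≡0⇒m≡0∨n≡0 ((zeros w ∸ 1) choose a) deficit≡0))))

unit-deficit⇒edge : ∀ {a b z o} → 3 ≤ suc a + suc b → suc a + suc b + 2 ≤ z + o → 0 < z → 0 < o →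
  deficit (suc a) z o b ≡ 1 → (a ≡ 0 × o ≡ suc b) ⊎ (z ≡ suc a × b ≡ 0)
unit-deficit⇒edge {a} {b} {suc z} {suc o} 3≤ size _ _ unit =
  classify (choose≡1⇒ (m*n≡1⇒m≡1 (z choose a) _ unit))
           (choose≡1⇒ (m*n≡1⇒n≡1 (z choose a) (o choose b) unit))
  where
  classify : a ≡ 0 ⊎ a ≡ z → b ≡ 0 ⊎ b ≡ o → (a ≡ 0 × suc o ≡ suc b) ⊎ (suc z ≡ suc a × b ≡ 0)
  classify (inj₁ refl) (inj₁ refl) = contradiction 3≤ λ { (s≤s (s≤s ())) }
  classify (inj₁ a≡0)  (inj₂ b≡o)  = inj₁ (a≡0 , cong suc (sym b≡o))
  classify (inj₂ a≡z)  (inj₁ b≡0)  = inj₂ (cong suc (sym a≡z) , b≡0)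
  classify (inj₂ refl) (inj₂ refl) = contradiction size (m+1+n≰m (suc a + suc b))

x+y+2≤z+y⇒x+2≤z : ∀ x y {z} → x + y + 2 ≤ z + y → x + 2 ≤ z
x+y+2≤z+y⇒x+2≤z x y {z} le = +-cancelʳ-≤ y (x + 2) z (subst (_≤ z + y) (rearrange x y) le)
  where
  rearrange : ∀ x y → x + y + 2 ≡ x + 2 + y
  rearrange = solve-∀

3≤k⇒1+x<x*k : ∀ {x k} → 0 < x → 3 ≤ k → suc x < x * k
3≤k⇒1+x<x*k {suc x} {k} _ 3≤k = ≤-trans (+-monoʳ-≤ 3 (m≤m*n x 3)) (*-monoʳ-≤ (suc x) 3≤k)

zero-edge-not-max : ∀ b z → 0 < z → 0 < b →
  sortedCount 0 b (suc z + suc b) (suc z) < sortedCount 0 b (suc z + suc b) z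
zero-edge-not-max b z 0<z 0<b = begin-strict
  sortedCount 0 b (suc z + suc b) (suc z)
    ≡⟨ cong₂ _*_ (choose-1 (suc z))
                 (trans (cong (_choose suc b) (m+n∸m≡n (suc z) (suc b))) (choose-diag (suc b))) ⟩
  suc z * 1         ≡⟨ *-identityʳ (suc z) ⟩
  suc z             <⟨ 3≤k⇒1+x<x*k 0<z (s≤s (s≤s 0<b)) ⟩
  z * suc (suc b)   ≡⟨ cong₂ _*_ (choose-1 z) (trans (cong (_choose suc b) n∸z≡2+b) (suc-choose-diag (suc b))) ⟨
  sortedCount 0 b (suc z + suc b) z ∎
  where
  open ≤-Reasoning
  n∸z≡2+b : suc z + suc b ∸ z ≡ suc (suc b)
  n∸z≡2+b = trans (cong (_∸ z) (sym (+-suc z (suc b)))) (m+n∸m≡n z (suc (suc b)))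

one-edge-not-max : ∀ a o → 0 < a → 0 < o →
  sortedCount a 0 (suc a + suc o) (suc a) < sortedCount a 0 (suc a + suc o) (suc (suc a))
one-edge-not-max a o 0<a 0<o = begin-strict
  sortedCount a 0 (suc a + suc o) (suc a)
    ≡⟨ cong₂ _*_ (choose-diag (suc a))
                 (trans (cong (_choose 1) (m+n∸m≡n (suc a) (suc o))) (choose-1 (suc o))) ⟩
  1 * suc o         ≡⟨ *-identityˡ (suc o) ⟩
  suc o             <⟨ 3≤k⇒1+x<x*k 0<o (s≤s (s≤s 0<a)) ⟩
  o * suc (suc a)   ≡⟨ *-comm o (suc (suc a)) ⟩
  suc (suc a) * o   ≡⟨ cong₂ _*_ (suc-choose-diag (suc a)) (trans (cong (_choose 1) n∸2+a≡o) (choose-1 o)) ⟨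
  sortedCount a 0 (suc a + suc o) (suc (suc a)) ∎
  where
  open ≤-Reasoning
  n∸2+a≡o : suc a + suc o ∸ suc (suc a) ≡ o
  n∸2+a≡o = trans (cong (λ x → suc x ∸ suc (suc a)) (+-suc a o)) (m+n∸m≡n (suc (suc a)) o)

edge-not-max : ∀ {a b z o} → 3 ≤ suc a + suc b → suc a + suc b + 2 ≤ z + o →
  (a ≡ 0 × o ≡ suc b) ⊎ (z ≡ suc a × b ≡ 0) →
  ∃[ y ] y ≤ z + o × sortedCount a b (z + o) z < sortedCount a b (z + o) y
edge-not-max {b = b} {z} 3≤ size (inj₁ (refl , refl)) with z | x+y+2≤z+y⇒x+2≤z 1 (suc b) size
... | suc z | s≤s 2≤z =
  z , ≤-trans (n≤1+n z) (m≤m+n (suc z) (suc b)) ,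
  zero-edge-not-max b z (≤-trans (s≤s z≤n) 2≤z) (s≤s⁻¹ (s≤s⁻¹ 3≤))
edge-not-max {a} {o = o} 3≤ size (inj₂ (refl , refl)) with o | m+n+o≤m+p⇒n+o≤p (suc a) 1 2 size
... | suc o | s≤s 2≤o =
  suc (suc a) , s≤s (≤-trans (≤-reflexive (+-comm 1 a)) (+-monoʳ-≤ a (s≤s z≤n))) ,
  one-edge-not-max a o (+-cancelʳ-≤ 1 1 a (s≤s⁻¹ 3≤)) (≤-trans (s≤s z≤n) 2≤o)

unsorted-count≢max∸1 : ∀ {a b n} peak → 3 ≤ suc a + suc b → suc a + suc b + 2 ≤ n →
  (∀ {y} → y ≤ n → sortedCount a b n y ≤ sortedCount a b n peak) → 2 ≤ sortedCount a b n peak →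
  ∀ w → length w ≡ n → Unsorted w → c (block (suc a) (suc b)) w ≢ sortedCount a b n peak ∸ 1
unsorted-count≢max∸1 {a} {b} {n} peak 3≤ size is-max 2≤m w lw u count≡m∸1
  with trans (sym lw) (length≡zeros+ones w)
... | refl =
  let y , y≤n , Fz<Fy = edge-not-max 3≤ size
                          (unit-deficit⇒edge 3≤ size (Unsorted⇒0<zeros u) (Unsorted⇒0<ones u) deficit≡1)
  in <⇒≱ Fz<Fy (≤-trans (is-max y≤n) m≤Fz)
  where
  z = zeros w
  o = ones w
  m = sortedCount a b (z + o) peak
  count = c (block (suc a) (suc b)) w
  d = deficit (suc a) z o b
  count+d≤Fz : count + d ≤ sortedCount a b (z + o) z
  count+d≤Fz = subst (count + d ≤_) (cong (λ x → z choose suc a * x choose suc b) (sym (m+n∸m≡n z o)))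
                     (c-unsorted (suc a) b u)
  m≡count+1 : m ≡ count + 1
  m≡count+1 = trans (sym (m∸n+n≡m (≤-trans (s≤s z≤n) 2≤m))) (cong (_+ 1) (sym count≡m∸1))
  deficit≡1 : d ≡ 1
  deficit≡1 = ≤-antisym
    (+-cancelˡ-≤ count d 1 (≤-trans count+d≤Fz (≤-trans (is-max (m≤m+n z o)) (≤-reflexive m≡count+1))))
    (unsorted-deficit-pos a b u (subst (0 <_) (sym count≡m∸1) (∸-monoˡ-≤ 1 2≤m)))
  m≤Fz : m ≤ sortedCount a b (z + o) z
  m≤Fz = ≤-trans (≤-reflexive (trans m≡count+1 (cong (count +_) (sym deficit≡1)))) count+d≤Fz

c-block≤sortedCount : ∀ a b {n} w → length w ≡ n → c (block (suc a) (suc b)) w ≤ sortedCount a b n (zeros w)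
c-block≤sortedCount a b w lw = subst (λ x → c (block (suc a) (suc b)) w ≤ zeros w choose suc a * x choose suc b)
                                     (ones≡n∸zeros w lw) (c-block≤ (suc a) (suc b) w)

c-block-sorted : ∀ a b {n} w → length w ≡ n → w ≡ block (zeros w) (ones w) →
  c (block (suc a) (suc b)) w ≡ sortedCount a b n (zeros w)
c-block-sorted a b w lw sorted = begin
  c (block (suc a) (suc b)) w                    ≡⟨ cong (c (block (suc a) (suc b))) sorted ⟩
  c (block (suc a) (suc b)) (block (zeros w) (ones w))
                                                 ≡⟨ c-block-block (suc a) (suc b) (zeros w) (ones w) ⟩
  zeros w choose suc a * ones w choose suc b     ≡⟨ cong (λ x → zeros w choose suc a * x choose suc b)
                                                         (ones≡n∸zeros w lw) ⟩
  sortedCount a b _ (zeros w)                    ∎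
  where open ≡-Reasoning

2≤sortedCount : ∀ a b {n} → suc a + suc b + 2 ≤ n → 2 ≤ sortedCount a b n (suc a)
2≤sortedCount a b {n} size = begin
  2                              ≤⟨ m≤n+m 2 (suc b) ⟩
  suc b + 2                      ≤⟨ room ⟩
  n ∸ suc a                      ≤⟨ 0<k<n⇒n≤choose (s≤s z≤n) (<-≤-trans (m<m+n (suc b) (s≤s z≤n)) room) ⟩
  (n ∸ suc a) choose suc b       ≡⟨ *-identityˡ _ ⟨
  1 * (n ∸ suc a) choose suc b   ≡⟨ cong (_* (n ∸ suc a) choose suc b) (choose-diag (suc a)) ⟨
  sortedCount a b n (suc a)      ∎
  where
  open ≤-Reasoning
  room : suc b + 2 ≤ n ∸ suc a
  room = m+n≤o⇒m≤o∸n (suc b + 2) (subst (_≤ n) (trans (+-assoc (suc a) (suc b) 2) (+-comm (suc a) _)) size)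

≡⊎+2≤⇒≢pred : ∀ {m k} → 0 < m → k ≡ m ⊎ k + 2 ≤ m → k ≢ m ∸ 1
≡⊎+2≤⇒≢pred {suc m} _ (inj₁ refl) = <⇒≢ (n<1+n m) ∘ sym
≡⊎+2≤⇒≢pred {suc m} _ (inj₂ m+2≤1+m) refl = 1+n≰n (s≤s⁻¹ (subst (_≤ suc m) (+-comm m 2) m+2≤1+m))

sorted-count≢max∸1 : ∀ {a b n peak} → 3 ≤ suc a + suc b → suc a + suc b + 2 ≤ n →
  peak ≤ n → (∀ {y} → y ≤ n → sortedCount a b n y ≤ sortedCount a b n peak) → 0 < sortedCount a b n peak →
  ∀ w → length w ≡ n → w ≡ block (zeros w) (ones w) →
  c (block (suc a) (suc b)) w ≢ sortedCount a b n peak ∸ 1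
sorted-count≢max∸1 {a} {b} 3≤ size peak≤n is-max 0<max w lw sorted = ≡⊎+2≤⇒≢pred 0<max
  (subst (λ x → x ≡ _ ⊎ x + 2 ≤ _) (sym (c-block-sorted a b w lw sorted))
         (sortedCount-max-or-gap 3≤ size peak≤n is-max (zeros≤length w lw)))

record SpectrumGap (p : Word) (n m : ℕ) : Set where
  field
    max-attained  : ∃[ w ] length w ≡ n × c p w ≡ m
    zero-attained : ∃[ w ] length w ≡ n × c p w ≡ 0
    count≤max     : ∀ w → length w ≡ n → c p w ≤ m
    count≢max∸1   : ∀ w → length w ≡ n → c p w ≢ m ∸ 1
    2≤max         : 2 ≤ m

block-spectrumGap : ∀ a b n → 3 ≤ suc a + suc b → suc a + suc b + 2 ≤ n →
  ∃[ m ] SpectrumGap (block (suc a) (suc b)) n m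
block-spectrumGap a b n 3≤ size =
  let peak , peak≤n , is-max = argmax (sortedCount a b n) n
      2≤max = ≤-trans (2≤sortedCount a b size) (is-max 1+a≤n)
  in
  sortedCount a b n peak , record
    { max-attained  = block peak (n ∸ peak) , trans (length-block peak (n ∸ peak)) (m+[n∸m]≡n peak≤n)
                    , c-block-block (suc a) (suc b) peak (n ∸ peak)
    ; zero-attained = replicate n true , length-replicate n , c-block-ones a (suc b) n
    ; count≤max     = λ w lw → ≤-trans (c-block≤sortedCount a b w lw) (is-max (zeros≤length w lw))
    ; count≢max∸1   = λ w lw → [ unsorted-count≢max∸1 peak 3≤ size is-max 2≤max w lw
                               , sorted-count≢max∸1 3≤ size peak≤n is-max (≤-trans (s≤s z≤n) 2≤max) w lw
                               ]′ (unsorted-or-sorted w)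
    ; 2≤max         = 2≤max
    }
  where
  1+a≤n : suc a ≤ n
  1+a≤n = m+n≤o⇒m≤o (suc a) (subst (_≤ n) (+-assoc (suc a) (suc b) 2) size)

c-complement : ∀ p w → c (map not p) (map not w) ≡ c p w
c-complement []          w           = refl
c-complement (x ∷ p)     []          = refl
c-complement (false ∷ p) (false ∷ w) rewrite c-complement (false ∷ p) w | c-complement p w = refl
c-complement (false ∷ p) (true ∷ w)  rewrite c-complement (false ∷ p) w = refl
c-complement (true ∷ p)  (false ∷ w) rewrite c-complement (true ∷ p) w = refl
c-complement (true ∷ p)  (true ∷ w)  rewrite c-complement (true ∷ p) w | c-complement p w = refl

map-not-involutive : ∀ w → map not (map not w) ≡ w
map-not-involutive w = trans (sym (map-∘ w)) (trans (map-cong not-involutive w) (map-id w))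

c-complementˡ : ∀ p w → c (map not p) w ≡ c p (map not w)
c-complementˡ p w = trans (cong (c (map not p)) (sym (map-not-involutive w))) (c-complement p (map not w))

SpectrumGap-complement : ∀ {p n m} → SpectrumGap p n m → SpectrumGap (map not p) n m
SpectrumGap-complement {p} {n} {m} gap = record
  { max-attained  = flip-witness max-attained
  ; zero-attained = flip-witness zero-attained
  ; count≤max     = λ w lw → subst (_≤ m) (sym (c-complementˡ p w)) (count≤max (map not w) (flip-length w lw))
  ; count≢max∸1   = λ w lw → count≢max∸1 (map not w) (flip-length w lw) ∘ trans (sym (c-complementˡ p w))
  ; 2≤max         = 2≤max
  }
  where
  open SpectrumGap gap
  flip-length : ∀ w → length w ≡ n → length (map not w) ≡ n
  flip-length w = trans (length-map not w)
  flip-witness : ∀ {k} → ∃[ w ] length w ≡ n × c p w ≡ k → ∃[ w ] length w ≡ n × c (map not p) w ≡ k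
  flip-witness (w , lw , count≡k) = map not w , flip-length w lw , trans (c-complement p w) count≡k

runsFrom≡0⇒replicate : ∀ x w → runsFrom x w ≡ 0 → w ≡ replicate (length w) x
runsFrom≡0⇒replicate x     []          _  = refl
runsFrom≡0⇒replicate false (false ∷ w) eq = cong (false ∷_) (runsFrom≡0⇒replicate false w eq)
runsFrom≡0⇒replicate true  (true ∷ w)  eq = cong (true ∷_) (runsFrom≡0⇒replicate true w eq)

runsFrom≡1⇒two-blocks : ∀ x w → runsFrom x w ≡ 1 →
  ∃[ k ] ∃[ j ] w ≡ replicate k x ++ replicate (suc j) (not x)
runsFrom≡1⇒two-blocks false (false ∷ w) eq =
  let k , j , w≡ = runsFrom≡1⇒two-blocks false w eq in suc k , j , cong (false ∷_) w≡
runsFrom≡1⇒two-blocks true  (true ∷ w)  eq =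
  let k , j , w≡ = runsFrom≡1⇒two-blocks true w eq in suc k , j , cong (true ∷_) w≡
runsFrom≡1⇒two-blocks false (true ∷ w)  eq =
  0 , length w , cong (true ∷_) (runsFrom≡0⇒replicate true w (suc-injective eq))
runsFrom≡1⇒two-blocks true  (false ∷ w) eq =
  0 , length w , cong (false ∷_) (runsFrom≡0⇒replicate false w (suc-injective eq))

runs≡2⇒block : ∀ p → runs p ≡ 2 →
  ∃[ a ] ∃[ b ] (p ≡ block (suc a) (suc b) ⊎ map not p ≡ block (suc a) (suc b))
runs≡2⇒block (false ∷ w) eq =
  let k , j , w≡ = runsFrom≡1⇒two-blocks false w (suc-injective eq) in k , j , inj₁ (cong (false ∷_) w≡)
runs≡2⇒block (true ∷ w) eq =
  let k , j , w≡ = runsFrom≡1⇒two-blocks true w (suc-injective eq) in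
  k , j , inj₂ (cong (false ∷_) (begin
    map not w                                             ≡⟨ cong (map not) w≡ ⟩
    map not (replicate k true ++ replicate (suc j) false) ≡⟨ map-++ not (replicate k true) _ ⟩
    map not (replicate k true) ++ map not (replicate (suc j) false)
      ≡⟨ cong₂ _++_ (map-replicate not k true) (map-replicate not (suc j) false) ⟩
    replicate k false ++ replicate (suc j) true           ∎))
  where open ≡-Reasoning

two-run-spectrumGap : ∀ p n → runs p ≡ 2 → 3 ≤ length p → length p + 2 ≤ n → ∃[ m ] SpectrumGap p n m
two-run-spectrumGap p n runs≡2 3≤l size with runs≡2⇒block p runs≡2
... | a , b , inj₁ refl = block-spectrumGap a b n
  (subst (3 ≤_) (length-block (suc a) (suc b)) 3≤l) (subst (λ l → l + 2 ≤ n) (length-block (suc a) (suc b)) size)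
... | a , b , inj₂ p̄≡block =
  let m , gap = block-spectrumGap a b n (subst (3 ≤_) l≡ 3≤l) (subst (λ l → l + 2 ≤ n) l≡ size) in
  m , subst (λ q → SpectrumGap q n m) (trans (cong (map not) (sym p̄≡block)) (map-not-involutive p))
            (SpectrumGap-complement gap)
  where
  l≡ : length p ≡ suc a + suc b
  l≡ = trans (sym (length-map not p)) (trans (cong length p̄≡block) (length-block (suc a) (suc b)))

words-length : ∀ n → All (λ w → length w ≡ n) (words n)
words-length zero    = refl ∷ []
words-length (suc n) = extend (words-length n)
  where
  extend : ∀ {ws} → All (λ w → length w ≡ n) ws →
    All (λ w → length w ≡ suc n) (concatMap (λ w → (false ∷ w) ∷ (true ∷ w) ∷ []) ws)
  extend []         = []
  extend (lw ∷ lws) = cong suc lw ∷ cong suc lw ∷ extend lws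

∈-words : ∀ w → w ∈ words (length w)
∈-words []      = here refl
∈-words (x ∷ w) = extend x (∈-words w)
  where
  extend : ∀ x {w ws} → w ∈ ws → x ∷ w ∈ concatMap (λ v → (false ∷ v) ∷ (true ∷ v) ∷ []) ws
  extend false (here refl) = here refl
  extend true  (here refl) = there (here refl)
  extend x     (there w∈)  = there (there (extend x w∈))

∈-words-of-length : ∀ {n w} → length w ≡ n → w ∈ words n
∈-words-of-length {w = w} refl = ∈-words w

module _ {A : Set} (f : A → ℕ) where

  foldr-⊔-lub : ∀ {m xs} → All (λ x → f x ≤ m) xs → foldr (λ x k → f x ⊔ k) 0 xs ≤ m
  foldr-⊔-lub []           = z≤n
  foldr-⊔-lub (fx≤m ∷ all) = ⊔-lub fx≤m (foldr-⊔-lub all)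

  foldr-⊔-ub : ∀ {x xs} → x ∈ xs → f x ≤ foldr (λ x k → f x ⊔ k) 0 xs
  foldr-⊔-ub             (here refl) = m≤m⊔n _ _
  foldr-⊔-ub {xs = y ∷ _} (there x∈) = ≤-trans (foldr-⊔-ub x∈) (m≤n⊔m (f y) _)

M≡max : ∀ {n p m} → ∃[ w ] length w ≡ n × c p w ≡ m → (∀ w → length w ≡ n → c p w ≤ m) → M n p ≡ m
M≡max {n} {p} (w , lw , count≡m) count≤m = ≤-antisym
  (foldr-⊔-lub (c p) (All.map (λ {w} → count≤m w) (words-length n)))
  (subst (_≤ M n p) count≡m (foldr-⊔-ub (c p) (∈-words-of-length lw)))

B≡0 : ∀ {n p k} → (∀ w → length w ≡ n → c p w ≢ k) → B n p k ≡ 0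
B≡0 {n} {p} {k} count≢k =
  cong length (filter-none (λ w → c p w ≟ k) (All.map (λ {w} → count≢k w) (words-length n)))

B≢0 : ∀ {n p k} → ∃[ w ] length w ≡ n × c p w ≡ k → B n p k ≢ 0
B≢0 {n} {p} {k} (w , lw , count≡k) =
  <⇒≢ (filter-some (λ w → c p w ≟ k) (Any.map (λ { refl → count≡k }) (∈-words-of-length lw))) ∘ sym

SpectrumGap⇒internal-zero : ∀ {p n m} → SpectrumGap p n m → (B n p (M n p ∸ 1) ≡ 0) × InternalZero n p
SpectrumGap⇒internal-zero {p} {n} {m} gap =
  subst (λ k → B n p (k ∸ 1) ≡ 0) (sym (M≡max {p = p} max-attained count≤max)) B[m∸1]≡0 ,
  0 , m ∸ 1 , m , ∸-monoˡ-≤ 1 2≤max , ∸-monoʳ-< (s≤s z≤n) (≤-trans (s≤s z≤n) 2≤max) ,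
  B≢0 {p = p} zero-attained , B≢0 {p = p} max-attained , B[m∸1]≡0
  where
  open SpectrumGap gap
  B[m∸1]≡0 : B n p (m ∸ 1) ≡ 0
  B[m∸1]≡0 = B≡0 {p = p} count≢max∸1

mainTheorem14 : (p : Word) → runs p ≡ 2 → 3 ≤ length p →
    (n : ℕ) → length p + 2 ≤ n →
    (B n p (M n p ∸ 1) ≡ 0) × InternalZero n p
mainTheorem14 p runs≡2 3≤l n size = SpectrumGap⇒internal-zero (proj₂ (two-run-spectrumGap p n runs≡2 3≤l size))
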